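{- Assume the limited principle of omniscience (LPO). Then for all $\alpha,\beta\in\mathrm{ord}_2$, we have $\alpha\le\beta$ or $\beta<\alpha$.
   Context: LPO: every sequence in $\{0,1\}$ either is identically $0$ or takes the value $1$ somewhere. $\mathfrak F_2=\{\mathbb N_k:k\in\mathbb N\}\cup\{\mathbb N\}$ with $\mathbb N_k=\{n\in\mathbb N:n<k\}$. The set $\mathrm{ord}_2$ of countable ordinals is defined inductively: a distinguished element $\underline 0$, and for every $I\in\mathfrak F_2$ and family $(\alpha_i)_{i\in I}$ in $\mathrm{ord}_2$ an element $\mathrm S(\alpha_i)_{i\in I}$. For $\alpha=\mathrm S(\alpha_i)_{i\in I}$, $\mathrm{In}_\alpha=I$; by convention $\mathrm{In}_{\underline0}=\emptyset$. For a finite list $F\subseteq_f\mathrm{In}_\alpha$, $\alpha_F$ is the list of the $\alpha_i$, $i\in F$. By simultaneous induction ($m\ge1$): $\alpha\le\beta^1,\dots,\beta^m$ means $\alpha_i<\beta^1,\dots,\beta^m$ for all $i\in\mathrm{In}_\alpha$; $\alpha<\beta^1,\dots,\beta^m$ means there exist $F_k\subseteq_f\mathrm{In}_{\beta^k}$, not all empty, with $\alpha\le\beta^1_{F_1},\dots,\beta^m_{F_m}$; $m=1$ gives binary $\le,<$ (which descend to the quotient $\mathrm{Ord}_2$). -}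

module Defs where

open import Data.Nat using (ℕ)
open import Data.Fin using (Fin)
open import Data.Bool using (Bool; true; false)
open import Data.Empty using (⊥)
open import Data.Unit using (⊤)
open import Data.List using (List; []; _∷_; _++_; map)
open import Data.Product using (Σ; _×_; ∃; _,_)
open import Data.Sum using (_⊎_)
open import Relation.Binary.PropositionalEquality using (_≡_)

LPO : Set
LPO = (f : ℕ → Bool) → (∀ n → f n ≡ false) ⊎ (∃ λ n → f n ≡ true)

-- Codes for the index sets in 𝔉₂ = {ℕ_k : k ∈ ℕ} ∪ {ℕ}.
data 𝔉₂ : Set where
  finite : ℕ → 𝔉₂      -- ℕ_k = {n | n < k}, represented as Fin k
  omega  : 𝔉₂

El : 𝔉₂ → Set
El (finite k) = Fin k
El omega      = ℕ

data ord₂ : Set where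
  zero₀ : ord₂
  S     : (I : 𝔉₂) → (El I → ord₂) → ord₂

In : ord₂ → Set
In zero₀   = ⊥
In (S I _) = El I

sub : (α : ord₂) → In α → ord₂
sub zero₀ ()
sub (S _ f) i = f i

subList : (α : ord₂) → List (In α) → List ord₂
subList α F = map (sub α) F

-- A choice of finite lists F_k ⊆_f In_{β^k}, one for each β^k in the list.
Choice : List ord₂ → Set
Choice []       = ⊤
Choice (β ∷ βs) = List (In β) × Choice βs

NonEmptyL : ∀ {A : Set} → List A → Set
NonEmptyL []      = ⊥
NonEmptyL (_ ∷ _) = ⊤

NotAllEmpty : (βs : List ord₂) → Choice βs → Set
NotAllEmpty []       _        = ⊥
NotAllEmpty (β ∷ βs) (F , Fs) = NonEmptyL F ⊎ NotAllEmpty βs Fs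

flatten : (βs : List ord₂) → Choice βs → List ord₂
flatten []       _        = []
flatten (β ∷ βs) (F , Fs) = subList β F ++ flatten βs Fs

mutual
  _≤*_ : ord₂ → List ord₂ → Set
  zero₀   ≤* βs = ⊤
  S I f ≤* βs = (i : El I) → f i <* βs

  _<*_ : ord₂ → List ord₂ → Set
  α <* βs = Σ (Choice βs) λ Fs → NotAllEmpty βs Fs × (α ≤* flatten βs Fs)

_≤₂_ : ord₂ → ord₂ → Set
α ≤₂ β = α ≤* (β ∷ [])

_<₂_ : ord₂ → ord₂ → Set
α <₂ β = α <* (β ∷ [])

{-# OPTIONS --safe #-}
-- Both alternatives are strengthened to lists on the right and proved by a
-- simultaneous induction: α ≤ β₁,…,βₘ or βₖ < α for every k, and dually
-- γ < β₁,…,βₘ or βₖ ≤ γ for every k.  Each step has to decide a statement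
-- quantified over an index set In_α; for finite index sets this is a finite
-- search, and for In_α = ℕ it is exactly what LPO provides.
module Submission where

open import Defs
open import Data.Bool using (Bool; true; false)
open import Data.Fin using (Fin; zero; suc)
open import Data.List using ([]; _∷_)
open import Data.List.Relation.Unary.All as All using (All; []; _∷_)
open import Data.Nat using (ℕ; zero; suc)
open import Data.Product using (∃; _,_)
open import Data.Sum using (_⊎_; inj₁; inj₂; swap)
open import Data.Unit using (tt)
open import Relation.Binary.PropositionalEquality using (_≡_; refl; sym; subst)

Searchable : Set → Set₁
Searchable A = ∀ {P Q : A → Set} → (∀ x → P x ⊎ Q x) → (∀ x → P x) ⊎ ∃ Q

Fin-searchable : ∀ k → Searchable (Fin k)
Fin-searchable zero    d = inj₁ λ ()
Fin-searchable (suc k) d with d zero | Fin-searchable k (λ i → d (suc i))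
... | inj₂ q | _            = inj₂ (zero , q)
... | inj₁ _ | inj₂ (i , q) = inj₂ (suc i , q)
... | inj₁ p | inj₁ ps      = inj₁ λ { zero → p ; (suc i) → ps i }

LPO⇒ℕ-searchable : LPO → Searchable ℕ
LPO⇒ℕ-searchable lpo {P} {Q} d = conclude (lpo (λ n → isInj₂ (d n)))
  where
  isInj₂ : ∀ {A B : Set} → A ⊎ B → Bool
  isInj₂ (inj₁ _) = false
  isInj₂ (inj₂ _) = true

  fromInj₁ : ∀ {A B : Set} (x : A ⊎ B) → isInj₂ x ≡ false → A
  fromInj₁ (inj₁ a) _ = a

  fromInj₂ : ∀ {A B : Set} (x : A ⊎ B) → isInj₂ x ≡ true → B
  fromInj₂ (inj₂ b) _ = b

  conclude : (∀ n → isInj₂ (d n) ≡ false) ⊎ ∃ (λ n → isInj₂ (d n) ≡ true) →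
             (∀ n → P n) ⊎ ∃ Q
  conclude (inj₁ none)       = inj₁ λ n → fromInj₁ (d n) (none n)
  conclude (inj₂ (n , some)) = inj₂ (n , fromInj₂ (d n) some)

LPO⇒El-searchable : LPO → ∀ I → Searchable (El I)
LPO⇒El-searchable _   (finite k) = Fin-searchable k
LPO⇒El-searchable lpo omega      = LPO⇒ℕ-searchable lpo

noChoice : ∀ βs → Choice βs
noChoice []       = tt
noChoice (_ ∷ βs) = [] , noChoice βs

flatten-noChoice : ∀ βs → flatten βs (noChoice βs) ≡ []
flatten-noChoice []       = refl
flatten-noChoice (_ ∷ βs) = flatten-noChoice βs

<*-here : ∀ {γ β} βs (j : In β) → γ ≤₂ sub β j → γ <* (β ∷ βs)
<*-here {γ} {β} βs j γ≤βⱼ =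
  (j ∷ [] , noChoice βs) , inj₁ tt ,
  subst (λ rest → γ ≤* (sub β j ∷ rest)) (sym (flatten-noChoice βs)) γ≤βⱼ

<*-there : ∀ {γ βs} β → γ <* βs → γ <* (β ∷ βs)
<*-there _ (Fs , nonEmpty , γ≤βs) = ([] , Fs) , inj₂ nonEmpty , γ≤βs

module _ (lpo : LPO) where

  -- The call to ≤*-or-all-<₂ keeps γ but passes to the subterms f i of γ = S I f
  -- before re-entering <*-or-all-≤₂, so every cycle of calls descends in γ.
  mutual
    ≤*-or-all-<₂ : ∀ α βs → α ≤* βs ⊎ All (_<₂ α) βs
    ≤*-or-all-<₂ zero₀   _  = inj₁ tt
    ≤*-or-all-<₂ (S I f) βs with LPO⇒El-searchable lpo I (λ i → <*-or-all-≤₂ (f i) βs)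
    ... | inj₁ α≤βs        = inj₁ α≤βs
    ... | inj₂ (i , βs≤αᵢ) = inj₂ (All.map (<*-here [] i) βs≤αᵢ)

    <*-or-all-≤₂ : ∀ γ βs → γ <* βs ⊎ All (_≤₂ γ) βs
    <*-or-all-≤₂ γ [] = inj₂ []
    <*-or-all-≤₂ γ (zero₀ ∷ βs) with <*-or-all-≤₂ γ βs
    ... | inj₁ γ<βs = inj₁ (<*-there zero₀ γ<βs)
    ... | inj₂ βs≤γ = inj₂ (tt ∷ βs≤γ)
    <*-or-all-≤₂ γ (S J g ∷ βs)
      with LPO⇒El-searchable lpo J (λ j → swap (≤*-or-all-<₂ γ (g j ∷ [])))
    ... | inj₂ (j , γ≤gⱼ) = inj₁ (<*-here βs j γ≤gⱼ)
    ... | inj₁ g<γ with <*-or-all-≤₂ γ βs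
    ...   | inj₁ γ<βs = inj₁ (<*-there (S J g) γ<βs)
    ...   | inj₂ βs≤γ = inj₂ ((λ j → All.head (g<γ j)) ∷ βs≤γ)

proposition5p2 : LPO → (α β : ord₂) → (α ≤₂ β) ⊎ (β <₂ α)
proposition5p2 lpo α β with ≤*-or-all-<₂ lpo α (β ∷ [])
... | inj₁ α≤β       = inj₁ α≤β
... | inj₂ (β<α ∷ []) = inj₂ β<α
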